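{- Let $\mathbf d=(\mathbf a,\mathbf b)$ be a bidegree sequence with $\mathbf a=(a_1,\dots,a_N)$, $\mathbf b=(b_1,\dots,b_N)$, and let $i\neq j$ be two indices with $a_j\le a_i$. For $k\ge 0$ define the set of bidegree sequences $$X_k=X_k(i,j;\mathbf d)=\Big\{(\mathbf a-a_i\mathbf e_i-a_j\mathbf e_j,\ \mathbf b-\mathbf s):\ \mathbf s\in\{0,1,2\}^N,\ \#\{n:s_n=2\}=k,\ \textstyle\sum_{n=1}^N s_n=a_i+a_j\Big\}.$$ Then $$\|G_{\mathbf d}\|=\sum_{k=0}^{a_j}\binom{a_i+a_j-2k}{a_j-k}\,\|G_{X_k}\|.$$
   Context: A bidegree sequence is a pair $\mathbf d=(\mathbf a,\mathbf b)$ of integer vectors in $\mathbb Z^N$; $\mathbf a$ lists in-degrees and $\mathbf b$ out-degrees. $\|G_{\mathbf d}\|$ denotes the number of directed graphs on the vertex set $\{1,\dots,N\}$ in which every ordered pair $(u,v)$, including $u=v$ (loops), carries at most one edge, and node $n$ has in-degree $a_n$ and out-degree $b_n$ for all $n$; equivalently, the number of $N\times N$ $0$-$1$ matrices with row sums $a_1,\dots,a_N$ and column sums $b_1,\dots,b_N$. If $\mathbf d$ has a negative entry, $\|G_{\mathbf d}\|=0$. For a set $X$ of bidegree sequences, $\|G_X\|=\sum_{\mathbf r\in X}\|G_{\mathbf r}\|$. $\mathbf e_k$ is the $k$-th standard unit vector of $\mathbb Z^N$. -}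

module Defs where

open import Data.Bool using (Bool; true; false; if_then_else_; _∧_)
open import Data.Nat using (ℕ; zero; suc; _≡ᵇ_)
import Data.Nat as ℕ
open import Data.Integer using (ℤ; +_; -[1+_]; _-_; _*_; ∣_∣)
import Data.Integer as ℤ
open import Data.Fin using (Fin; zero; suc)
import Data.Fin as Fin
open import Data.List using (List; []; _∷_; map; concatMap; length; filterᵇ; allFin; upTo)
import Data.List as List
open import Data.Vec.Functional using (Vector) renaming (_∷_ to _∷ᵥ_)
open import Relation.Nullary.Decidable using (⌊_⌋)
open import Data.Nat.Combinatorics using (_C_)
open import Data.Nat.ListAction using (sum)
open import Data.Bool.ListAction using (and)

sumFin : (N : ℕ) → (Fin N → ℕ) → ℕ
sumFin zero    f = 0
sumFin (suc N) f = f zero ℕ.+ sumFin N (λ n → f (suc n))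

allVecs : {A : Set} → (N : ℕ) → List A → List (Vector A N)
allVecs zero    xs = (λ ()) ∷ []
allVecs (suc N) xs = concatMap (λ x → map (λ f → x ∷ᵥ f) (allVecs N xs)) xs

allMatrices : (N : ℕ) → List (Fin N → Fin N → Bool)
allMatrices N = allVecs N (allVecs N (true ∷ false ∷ []))

bit : Bool → ℕ
bit true  = 1
bit false = 0

rowSum : {N : ℕ} → (Fin N → Fin N → Bool) → Fin N → ℕ
rowSum {N} M r = sumFin N (λ c → bit (M r c))

colSum : {N : ℕ} → (Fin N → Fin N → Bool) → Fin N → ℕ
colSum {N} M c = sumFin N (λ r → bit (M r c))

realizes : {N : ℕ} → Vector ℤ N → Vector ℤ N → (Fin N → Fin N → Bool) → Bool
realizes {N} a b M =
  and (map (λ n → ⌊ (+ rowSum M n) ℤ.≟ a n ⌋ ∧ ⌊ (+ colSum M n) ℤ.≟ b n ⌋) (allFin N))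

-- ‖G_(a,b)‖ : number of N×N 0-1 matrices with row sums a, column sums b
-- (automatically 0 if some entry is negative)
countG : {N : ℕ} → Vector ℤ N → Vector ℤ N → ℕ
countG {N} a b = length (filterᵇ (realizes a b) (allMatrices N))

e : {N : ℕ} → Fin N → Vector ℤ N
e k n = if ⌊ k Fin.≟ n ⌋ then + 1 else + 0

_-ᵥ_ : {N : ℕ} → Vector ℤ N → Vector ℤ N → Vector ℤ N
(u -ᵥ v) n = u n - v n

_·ᵥ_ : {N : ℕ} → ℤ → Vector ℤ N → Vector ℤ N
(c ·ᵥ v) n = c * v n

sVecs : (N : ℕ) → ℕ → ℤ → List (Vector ℕ N)
sVecs N k t = filterᵇ
  (λ s → (sumFin N (λ n → if s n ≡ᵇ 2 then 1 else 0) ≡ᵇ k)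
         ∧ ⌊ (+ sumFin N s) ℤ.≟ t ⌋)
  (allVecs N (0 ∷ 1 ∷ 2 ∷ []))

toℤv : {N : ℕ} → Vector ℕ N → Vector ℤ N
toℤv s n = + s n

-- ‖G_{X_k(i,j;d)}‖ ; the map s ↦ b - s is injective, so summing over the
-- admissible s is the same as summing over the set X_k
countX : {N : ℕ} → Vector ℤ N → Vector ℤ N → Fin N → Fin N → ℕ → ℕ
countX {N} a b i j k =
  sum (map (λ s → countG ((a -ᵥ (a i ·ᵥ e i)) -ᵥ (a j ·ᵥ e j)) (b -ᵥ toℤv s))
                (sVecs N k (a i ℤ.+ a j)))

range0 : ℤ → List ℕ
range0 (+ m)     = upTo (suc m)
range0 -[1+ m ]  = []

-- Σ_{k=0}^{a_j} C(a_i+a_j-2k, a_j-k) ‖G_{X_k}‖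
-- (within the range all arguments of C are nonnegative integers)
rhs : {N : ℕ} → Vector ℤ N → Vector ℤ N → Fin N → Fin N → ℕ
rhs a b i j = sum (map
  (λ k → (∣ a i ℤ.+ a j - (+ 2) * (+ k) ∣ C ∣ a j - + k ∣) ℕ.* countX a b i j k)
  (range0 (a j)))

-- Split off rows i and j of the matrix. The remaining rows see them only through their sum
-- s = x + y ∈ {0,1,2}^N, which is added to the column sums. If s has n₁ entries 1 and n₂ entries 2,
-- the pairs (x, y) with row sums a_i and a_j exist only when n₁ + 2n₂ = a_i + a_j, and then there
-- are C(n₁, a_j − n₂) of them: both rows contain the 2s, and a_j − n₂ of the 1s go to row j. With
-- k = n₂ this is the coefficient C(a_i + a_j − 2k, a_j − k). On the other side, a matrix counted by
-- ‖G_{X_k}‖ has empty rows i and j, so it is just a choice of the other rows with column sums b − s.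

module Submission where

open import Defs
open import Data.Bool using (Bool; true; false; _∧_; if_then_else_)
open import Data.Bool.ListAction using (and)
open import Data.Integer using (ℤ; -[1+_])
import Data.Integer as ℤ
import Data.Integer.Properties as ℤ
open import Data.Nat using (ℕ; zero; suc; _+_; _*_; _∸_; _≤_; _<_; _≤?_; z≤n; s≤s)
import Data.Nat as ℕ
open import Data.Nat.Properties
open import Data.Nat.ListAction using (sum)
open import Data.Nat.ListAction.Properties using (sum-++)
open import Data.List using (List; []; _∷_; _++_; map; concatMap; filterᵇ; length; upTo; tabulate; allFin)
open import Data.List.Properties using (map-++; map-∘; map-upTo; map-tabulate)
open import Data.List.Membership.Propositional using (_∈_)
open import Data.List.Relation.Unary.Any using (here; there)
open import Data.Fin using (Fin; zero; suc; punchIn; punchOut)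
import Data.Fin as Fin
open import Data.Fin.Properties using (punchInᵢ≢i; punchIn-injective; punchIn-punchOut)
open import Data.Nat.Combinatorics using (_C_; k>n⇒nCk≡0; nCk+nC[k+1]≡[n+1]C[k+1])
open import Data.Vec.Functional using (Vector; insertAt; removeAt) renaming (_∷_ to _∷ᵥ_)
open import Data.Vec.Functional.Properties using (insertAt-lookup; insertAt-punchIn)
open import Function using (_∘_)
open import Relation.Nullary.Negation using (contradiction)
open import Relation.Nullary.Decidable using (Dec; ⌊_⌋; does; yes; no; map′; dec-true; dec-false; does-≡; isYes≗does)
open import Relation.Binary.PropositionalEquality
open import Data.Nat.Solver using (module +-*-Solver)
open +-*-Solver using (solve; _:+_; _:*_; _:=_; con)
open import Algebra.Properties.CommutativeSemigroup +-commutativeSemigroup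
  using () renaming (interchange to +-interchange)
open import Algebra.Properties.CommutativeSemigroup *-commutativeSemigroup
  using () renaming (x∙yz≈y∙xz to *-left-comm)
open import Algebra.Properties.AbelianGroup ℤ.+-0-abelianGroup using (//-rightDividesˡ; //-rightDividesʳ)
open import Algebra.Properties.CommutativeMonoid.Sum +-0-commutativeMonoid
  using () renaming (sum to ∑ᶠ; sum-remove to ∑ᶠ-remove)
open import Algebra.Properties.CommutativeMonoid.Sum *-1-commutativeMonoid
  using () renaming (sum to ∏; sum-remove to ∏-remove; sum-cong-≗ to ∏-cong)

private variable
  A B : Set

∑ : List A → (A → ℕ) → ℕ
∑ xs f = sum (map f xs)

infix 5 ∑
syntax ∑ xs (λ x → e) = ∑[ x ∈ xs ] e

∑-cong : (xs : List A) {f g : A → ℕ} → f ≗ g → ∑ xs f ≡ ∑ xs g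
∑-cong []       f≗g = refl
∑-cong (x ∷ xs) f≗g = cong₂ _+_ (f≗g x) (∑-cong xs f≗g)

∑-cong-∈ : (xs : List A) {f g : A → ℕ} → (∀ {x} → x ∈ xs → f x ≡ g x) → ∑ xs f ≡ ∑ xs g
∑-cong-∈ []       f≗g = refl
∑-cong-∈ (x ∷ xs) f≗g = cong₂ _+_ (f≗g (here refl)) (∑-cong-∈ xs (f≗g ∘ there))

∑-zero : (xs : List A) {f : A → ℕ} → (∀ x → f x ≡ 0) → ∑ xs f ≡ 0
∑-zero []       f≗0 = refl
∑-zero (x ∷ xs) f≗0 = cong₂ _+_ (f≗0 x) (∑-zero xs f≗0)

∑-++ : (xs ys : List A) (f : A → ℕ) → ∑ (xs ++ ys) f ≡ ∑ xs f + ∑ ys f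
∑-++ xs ys f = trans (cong sum (map-++ f xs ys)) (sum-++ (map f xs) (map f ys))

∑-map : (xs : List B) (h : B → A) (f : A → ℕ) → ∑ (map h xs) f ≡ ∑ xs (f ∘ h)
∑-map xs h f = cong sum (sym (map-∘ xs))

∑-concatMap : (xs : List B) (k : B → List A) (f : A → ℕ) →
  ∑ (concatMap k xs) f ≡ ∑[ x ∈ xs ] ∑ (k x) f
∑-concatMap []       k f = refl
∑-concatMap (x ∷ xs) k f =
  trans (∑-++ (k x) (concatMap k xs) f) (cong (∑ (k x) f +_) (∑-concatMap xs k f))

∑-+ : (xs : List A) (f g : A → ℕ) → ∑[ x ∈ xs ] (f x + g x) ≡ ∑ xs f + ∑ xs g
∑-+ []       f g = refl
∑-+ (x ∷ xs) f g = trans (cong (f x + g x +_) (∑-+ xs f g)) (+-interchange (f x) (g x) _ _)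

∑-*ˡ : (c : ℕ) (xs : List A) (f : A → ℕ) → ∑[ x ∈ xs ] c * f x ≡ c * ∑ xs f
∑-*ˡ c []       f = sym (*-zeroʳ c)
∑-*ˡ c (x ∷ xs) f = trans (cong (c * f x +_) (∑-*ˡ c xs f)) (sym (*-distribˡ-+ c (f x) _))

∑-pull : (c : ℕ) (xs : List A) (f g : A → ℕ) → ∑[ x ∈ xs ] f x * (c * g x) ≡ c * (∑[ x ∈ xs ] f x * g x)
∑-pull c xs f g = trans (∑-cong xs (λ x → *-left-comm (f x) c (g x))) (∑-*ˡ c xs _)

∑-comm : (xs : List A) (ys : List B) (f : A → B → ℕ) →
  ∑[ x ∈ xs ] ∑[ y ∈ ys ] f x y ≡ ∑[ y ∈ ys ] ∑[ x ∈ xs ] f x y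
∑-comm []       ys f = sym (∑-zero ys (λ _ → refl))
∑-comm (x ∷ xs) ys f =
  trans (cong (∑ ys (f x) +_) (∑-comm xs ys f)) (sym (∑-+ ys (f x) (λ y → ∑[ x ∈ xs ] f x y)))

∑-interchange : (xs : List A) (ys : List B) (f : A → ℕ) (g : B → ℕ) (h : A → B → ℕ) →
  ∑[ x ∈ xs ] f x * (∑[ y ∈ ys ] g y * h x y) ≡ ∑[ y ∈ ys ] g y * (∑[ x ∈ xs ] f x * h x y)
∑-interchange xs ys f g h = begin
  ∑[ x ∈ xs ] f x * (∑[ y ∈ ys ] g y * h x y)   ≡⟨ ∑-cong xs (λ x → sym (∑-*ˡ (f x) ys _)) ⟩
  ∑[ x ∈ xs ] ∑[ y ∈ ys ] f x * (g y * h x y)   ≡⟨ ∑-comm xs ys _ ⟩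
  ∑[ y ∈ ys ] ∑[ x ∈ xs ] f x * (g y * h x y)   ≡⟨ ∑-cong ys (λ y → ∑-pull (g y) xs f (λ x → h x y)) ⟩
  ∑[ y ∈ ys ] g y * (∑[ x ∈ xs ] f x * h x y)   ∎
  where open ≡-Reasoning

∑-filterᵇ : (p : A → Bool) (xs : List A) (f : A → ℕ) →
  ∑ (filterᵇ p xs) f ≡ ∑[ x ∈ xs ] bit (p x) * f x
∑-filterᵇ p []       f = refl
∑-filterᵇ p (x ∷ xs) f with p x
... | true  = cong₂ _+_ (sym (*-identityˡ (f x))) (∑-filterᵇ p xs f)
... | false = ∑-filterᵇ p xs f

length-filterᵇ : (p : A → Bool) (xs : List A) → length (filterᵇ p xs) ≡ ∑[ x ∈ xs ] bit (p x)
length-filterᵇ p []       = refl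
length-filterᵇ p (x ∷ xs) with p x
... | true  = cong suc (length-filterᵇ p xs)
... | false = length-filterᵇ p xs

≗-Invariant : {n : ℕ} → (Vector A n → ℕ) → Set _
≗-Invariant F = ∀ {u v} → u ≗ v → F u ≡ F v

∑-allVecs-suc : (N : ℕ) (xs : List A) (F : Vector A (suc N) → ℕ) →
  ∑ (allVecs (suc N) xs) F ≡ ∑[ x ∈ xs ] ∑[ v ∈ allVecs N xs ] F (x ∷ᵥ v)
∑-allVecs-suc N xs F =
  trans (∑-concatMap xs _ F) (∑-cong xs (λ x → ∑-map (allVecs N xs) (x ∷ᵥ_) F))

∑-allVecs-cong : (N : ℕ) (xs : List A) {F G : Vector A N → ℕ} →
  (∀ {v} → (∀ c → v c ∈ xs) → F v ≡ G v) → ∑ (allVecs N xs) F ≡ ∑ (allVecs N xs) G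
∑-allVecs-cong zero    xs F≗G = cong (_+ 0) (F≗G (λ ()))
∑-allVecs-cong (suc N) xs {F} {G} F≗G = begin
  ∑ (allVecs (suc N) xs) F                   ≡⟨ ∑-allVecs-suc N xs F ⟩
  ∑[ x ∈ xs ] ∑[ v ∈ allVecs N xs ] F (x ∷ᵥ v) ≡⟨ ∑-cong-∈ xs (λ x∈xs → ∑-allVecs-cong N xs
                                                   (λ v∈xs → F≗G (λ { zero → x∈xs ; (suc c) → v∈xs c }))) ⟩
  ∑[ x ∈ xs ] ∑[ v ∈ allVecs N xs ] G (x ∷ᵥ v) ≡⟨ ∑-allVecs-suc N xs G ⟨
  ∑ (allVecs (suc N) xs) G                   ∎
  where open ≡-Reasoning

∑-allVecs-insertAt : (n : ℕ) (xs : List A) (i : Fin (suc n)) (F : Vector A (suc n) → ℕ) → ≗-Invariant F →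
  ∑ (allVecs (suc n) xs) F ≡ ∑[ x ∈ xs ] ∑[ v ∈ allVecs n xs ] F (insertAt v i x)
∑-allVecs-insertAt n xs zero F F-inv =
  trans (∑-allVecs-suc n xs F)
        (∑-cong xs (λ x → ∑-cong (allVecs n xs) (λ v → F-inv (λ { zero → refl ; (suc r) → refl }))))
∑-allVecs-insertAt (suc n) xs (suc i) F F-inv = begin
  ∑ (allVecs (suc (suc n)) xs) F
    ≡⟨ ∑-allVecs-suc (suc n) xs F ⟩
  ∑[ y ∈ xs ] ∑[ w ∈ allVecs (suc n) xs ] F (y ∷ᵥ w)
    ≡⟨ ∑-cong xs (λ y → ∑-allVecs-insertAt n xs i (F ∘ (y ∷ᵥ_))
                          (λ u≗v → F-inv (λ { zero → refl ; (suc r) → u≗v r }))) ⟩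
  ∑[ y ∈ xs ] ∑[ x ∈ xs ] ∑[ v ∈ allVecs n xs ] F (y ∷ᵥ insertAt v i x)
    ≡⟨ ∑-comm xs xs _ ⟩
  ∑[ x ∈ xs ] ∑[ y ∈ xs ] ∑[ v ∈ allVecs n xs ] F (y ∷ᵥ insertAt v i x)
    ≡⟨ ∑-cong xs (λ x → trans (∑-allVecs-suc n xs (λ w → F (insertAt w (suc i) x)))
         (∑-cong xs (λ y → ∑-cong (allVecs n xs) (λ v → F-inv (λ { zero → refl ; (suc r) → refl }))))) ⟨
  ∑[ x ∈ xs ] ∑[ w ∈ allVecs (suc n) xs ] F (insertAt w (suc i) x)
    ∎
  where open ≡-Reasoning

∏-distrib-* : {n : ℕ} (f g : Vector ℕ n) → ∏ (λ c → f c * g c) ≡ ∏ f * ∏ g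
∏-distrib-* {zero}  f g = refl
∏-distrib-* {suc n} f g = trans (cong (f zero * g zero *_) (∏-distrib-* (f ∘ suc) (g ∘ suc)))
                                ([m*n]*[o*p]≡[m*o]*[n*p] (f zero) (g zero) _ _)

sumFin≡∑ᶠ : (N : ℕ) (f : Vector ℕ N) → sumFin N f ≡ ∑ᶠ f
sumFin≡∑ᶠ zero    f = refl
sumFin≡∑ᶠ (suc N) f = cong (f zero +_) (sumFin≡∑ᶠ N (f ∘ suc))

sumFin-cong : (N : ℕ) {f g : Vector ℕ N} → f ≗ g → sumFin N f ≡ sumFin N g
sumFin-cong zero    f≗g = refl
sumFin-cong (suc N) f≗g = cong₂ _+_ (f≗g zero) (sumFin-cong N (f≗g ∘ suc))

sumFin-remove : (n : ℕ) (f : Vector ℕ (suc n)) (i : Fin (suc n)) →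
  sumFin (suc n) f ≡ f i + sumFin n (removeAt f i)
sumFin-remove n f i = begin
  sumFin (suc n) f           ≡⟨ sumFin≡∑ᶠ (suc n) f ⟩
  ∑ᶠ f                       ≡⟨ ∑ᶠ-remove f ⟩
  f i + ∑ᶠ (removeAt f i)    ≡⟨ cong (f i +_) (sumFin≡∑ᶠ n (removeAt f i)) ⟨
  f i + sumFin n (removeAt f i) ∎
  where open ≡-Reasoning

bit-∧ : (x y : Bool) → bit (x ∧ y) ≡ bit x * bit y
bit-∧ true  y = sym (+-identityʳ (bit y))
bit-∧ false y = refl

bit-and : {n : ℕ} (g : Fin n → Bool) → bit (and (map g (allFin n))) ≡ ∏ (bit ∘ g)
bit-and g = trans (cong (bit ∘ and) (map-tabulate (λ i → i) g)) (bit-and-tabulate g)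
  where
  bit-and-tabulate : {n : ℕ} (g : Fin n → Bool) → bit (and (tabulate g)) ≡ ∏ (bit ∘ g)
  bit-and-tabulate {zero}  g = refl
  bit-and-tabulate {suc n} g = trans (bit-∧ (g zero) _) (cong (bit (g zero) *_) (bit-and-tabulate (g ∘ suc)))

δ : ℕ → ℕ → ℕ
δ m n = bit (m ℕ.≡ᵇ n)

δℤ : ℕ → ℤ → ℕ
δℤ n z = bit ⌊ ℤ.+ n ℤ.≟ z ⌋

δ-refl : (n : ℕ) → δ n n ≡ 1
δ-refl n = cong bit (dec-true (n ℕ.≟ n) refl)

δ-≢ : {m n : ℕ} → m ≢ n → δ m n ≡ 0
δ-≢ {m} {n} m≢n = cong bit (dec-false (m ℕ.≟ n) m≢n)

δℤ-+ : (n p : ℕ) → δℤ n (ℤ.+ p) ≡ δ n p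
δℤ-+ n p = cong bit (isYes≗does (ℤ.+ n ℤ.≟ ℤ.+ p))

δℤ-shift : (v s : ℕ) (z : ℤ) → δℤ v (z ℤ.- ℤ.+ s) ≡ δℤ (s + v) z
δℤ-shift v s z = cong bit (begin
  ⌊ shifted ⌋       ≡⟨ isYes≗does shifted ⟩
  does shifted      ≡⟨ does-≡ shifted (map′ from to unshifted) ⟩
  does unshifted    ≡⟨ isYes≗does unshifted ⟨
  ⌊ unshifted ⌋     ∎)
  where
  open ≡-Reasoning
  shifted   = ℤ.+ v ℤ.≟ z ℤ.- ℤ.+ s
  unshifted = ℤ.+ (s + v) ℤ.≟ z
  to : ℤ.+ v ≡ z ℤ.- ℤ.+ s → ℤ.+ (s + v) ≡ z
  to eq = trans (ℤ.+-comm (ℤ.+ s) (ℤ.+ v)) (trans (cong (ℤ._+ ℤ.+ s) eq) (//-rightDividesˡ (ℤ.+ s) z))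
  from : ℤ.+ (s + v) ≡ z → ℤ.+ v ≡ z ℤ.- ℤ.+ s
  from eq = trans (sym (//-rightDividesʳ (ℤ.+ s) (ℤ.+ v)))
                  (cong (ℤ._- ℤ.+ s) (trans (ℤ.+-comm (ℤ.+ v) (ℤ.+ s)) eq))

boolVecs : (N : ℕ) → List (Vector Bool N)
boolVecs N = allVecs N (true ∷ false ∷ [])

ones : {N : ℕ} → Vector Bool N → ℕ
ones {N} x = sumFin N (λ c → bit (x c))

Matrix : ℕ → ℕ → Set
Matrix m N = Vector (Vector Bool N) m

columnSum : {m N : ℕ} → Matrix m N → Fin N → ℕ
columnSum {m} M c = sumFin m (λ r → bit (M r c))

ColumnWeight : ℕ → Set
ColumnWeight N = Fin N → ℕ → ℕ

-- Arbitrary column weights h (countG is the case h c v = [v = b c]) make the class closed under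
-- removing a row: the row is absorbed into the column weight by shift (count-insertAt).
weight : {m N : ℕ} → Vector ℤ m → ColumnWeight N → Matrix m N → ℕ
weight a h M = ∏ (λ r → δℤ (ones (M r)) (a r)) * ∏ (λ c → h c (columnSum M c))

count : {N : ℕ} (m : ℕ) → Vector ℤ m → ColumnWeight N → ℕ
count {N} m a h = ∑ (allVecs m (boolVecs N)) (weight a h)

shift : {N : ℕ} → Vector ℕ N → ColumnWeight N → ColumnWeight N
shift s h c v = h c (s c + v)

bit-realizes : {N : ℕ} (a b : Vector ℤ N) (M : Matrix N N) →
  bit (realizes a b M) ≡ weight a (λ c v → δℤ v (b c)) M
bit-realizes a b M = begin
  bit (realizes a b M)            ≡⟨ bit-and (λ n → row n ∧ col n) ⟩
  ∏ (λ n → bit (row n ∧ col n))   ≡⟨ ∏-cong (λ n → bit-∧ (row n) (col n)) ⟩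
  ∏ (λ n → rows n * cols n)       ≡⟨ ∏-distrib-* rows cols ⟩
  ∏ rows * ∏ cols                 ∎
  where
  open ≡-Reasoning
  row col : Fin _ → Bool
  row r = ⌊ ℤ.+ ones (M r) ℤ.≟ a r ⌋
  col c = ⌊ ℤ.+ columnSum M c ℤ.≟ b c ⌋
  rows cols : Vector ℕ _
  rows = bit ∘ row
  cols = bit ∘ col

countG≡count : {N : ℕ} (a b : Vector ℤ N) → countG a b ≡ count N a (λ c v → δℤ v (b c))
countG≡count {N} a b = trans (length-filterᵇ (realizes a b) (allMatrices N))
                             (∑-cong (allMatrices N) (bit-realizes a b))

weight-cong : {m N : ℕ} (a : Vector ℤ m) (h : ColumnWeight N) → ≗-Invariant (weight a h)
weight-cong {m} a h M≗M′ = cong₂ _*_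
  (∏-cong (λ r → cong (λ row → δℤ (ones row) (a r)) (M≗M′ r)))
  (∏-cong (λ c → cong (h c) (sumFin-cong m (λ r → cong (λ row → bit (row c)) (M≗M′ r)))))

count-cong : {m N : ℕ} {a a′ : Vector ℤ m} {h h′ : ColumnWeight N} →
  a ≗ a′ → (∀ c v → h c v ≡ h′ c v) → count m a h ≡ count m a′ h′
count-cong {m} {N} a≗a′ h≗h′ = ∑-cong (allVecs m (boolVecs N)) (λ M → cong₂ _*_
  (∏-cong (λ r → cong (δℤ (ones (M r))) (a≗a′ r)))
  (∏-cong (λ c → h≗h′ c (columnSum M c))))

columnSum-insertAt : {m N : ℕ} (M : Matrix m N) (i : Fin (suc m)) (x : Vector Bool N) (c : Fin N) →
  columnSum (insertAt M i x) c ≡ bit (x c) + columnSum M c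
columnSum-insertAt {m} M i x c = begin
  columnSum (insertAt M i x) c
    ≡⟨ sumFin-remove m (λ r → bit (insertAt M i x r c)) i ⟩
  bit (insertAt M i x i c) + sumFin m (λ r → bit (insertAt M i x (punchIn i r) c))
    ≡⟨ cong₂ (λ row rows → bit (row c) + rows) (insertAt-lookup M i x)
             (sumFin-cong m (λ r → cong (λ row → bit (row c)) (insertAt-punchIn M i x r))) ⟩
  bit (x c) + columnSum M c
    ∎
  where open ≡-Reasoning

weight-insertAt : {m N : ℕ} (a : Vector ℤ (suc m)) (h : ColumnWeight N)
  (M : Matrix m N) (i : Fin (suc m)) (x : Vector Bool N) →
  weight a h (insertAt M i x) ≡ δℤ (ones x) (a i) * weight (removeAt a i) (shift (bit ∘ x) h) M
weight-insertAt a h M i x = begin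
  ∏ rows * ∏ (λ c → h c (columnSum (insertAt M i x) c))
    ≡⟨ cong₂ _*_ (∏-remove rows) (∏-cong (λ c → cong (h c) (columnSum-insertAt M i x c))) ⟩
  rows i * ∏ (removeAt rows i) * ∏ (λ c → shift (bit ∘ x) h c (columnSum M c))
    ≡⟨ cong (λ w → w * ∏ (λ c → shift (bit ∘ x) h c (columnSum M c))) (cong₂ _*_
         (cong (λ row → δℤ (ones row) (a i)) (insertAt-lookup M i x))
         (∏-cong (λ r → cong (λ row → δℤ (ones row) (a (punchIn i r))) (insertAt-punchIn M i x r)))) ⟩
  δℤ (ones x) (a i) * ∏ (λ r → δℤ (ones (M r)) (removeAt a i r)) * ∏ (λ c → shift (bit ∘ x) h c (columnSum M c))
    ≡⟨ *-assoc (δℤ (ones x) (a i)) _ _ ⟩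
  δℤ (ones x) (a i) * weight (removeAt a i) (shift (bit ∘ x) h) M
    ∎
  where
  open ≡-Reasoning
  rows : Vector ℕ _
  rows r = δℤ (ones (insertAt M i x r)) (a r)

count-insertAt : {m N : ℕ} (a : Vector ℤ (suc m)) (h : ColumnWeight N) (i : Fin (suc m)) →
  count (suc m) a h ≡ ∑[ x ∈ boolVecs N ] δℤ (ones x) (a i) * count m (removeAt a i) (shift (bit ∘ x) h)
count-insertAt {m} {N} a h i = begin
  count (suc m) a h
    ≡⟨ ∑-allVecs-insertAt m (boolVecs N) i (weight a h) (weight-cong a h) ⟩
  ∑[ x ∈ boolVecs N ] ∑[ M ∈ allVecs m (boolVecs N) ] weight a h (insertAt M i x)
    ≡⟨ ∑-cong (boolVecs N) (λ x → trans (∑-cong (allVecs m (boolVecs N)) (λ M → weight-insertAt a h M i x))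
                                        (∑-*ˡ (δℤ (ones x) (a i)) (allVecs m (boolVecs N)) _)) ⟩
  ∑[ x ∈ boolVecs N ] δℤ (ones x) (a i) * count m (removeAt a i) (shift (bit ∘ x) h)
    ∎
  where open ≡-Reasoning

∑-ones≡0 : (N : ℕ) (F : Vector Bool N → ℕ) → ≗-Invariant F →
  ∑[ x ∈ boolVecs N ] δ (ones x) 0 * F x ≡ F (λ _ → false)
∑-ones≡0 zero    F F-inv = trans (+-identityʳ _) (trans (*-identityˡ _) (F-inv (λ ())))
∑-ones≡0 (suc N) F F-inv = begin
  ∑[ x ∈ boolVecs (suc N) ] δ (ones x) 0 * F x
    ≡⟨ ∑-allVecs-suc N _ _ ⟩
  (∑[ x ∈ boolVecs N ] 0 * F (true ∷ᵥ x)) + ((∑[ x ∈ boolVecs N ] δ (ones x) 0 * F (false ∷ᵥ x)) + 0)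
    ≡⟨ cong₂ (λ m n → m + (n + 0)) (∑-zero (boolVecs N) (λ _ → refl))
                                   (∑-ones≡0 N (F ∘ (false ∷ᵥ_)) (λ u≗v → F-inv (cons-cong u≗v))) ⟩
  F (false ∷ᵥ (λ _ → false)) + 0
    ≡⟨ trans (+-identityʳ _) (F-inv (λ { zero → refl ; (suc c) → refl })) ⟩
  F (λ _ → false)
    ∎
  where
  open ≡-Reasoning
  cons-cong : {u v : Vector Bool N} → u ≗ v → (false ∷ᵥ u) ≗ (false ∷ᵥ v)
  cons-cong u≗v zero    = refl
  cons-cong u≗v (suc c) = u≗v c

count-insertAt-zero : {m N : ℕ} (a : Vector ℤ (suc m)) (h : ColumnWeight N) (i : Fin (suc m)) →
  a i ≡ ℤ.+ 0 → count (suc m) a h ≡ count m (removeAt a i) h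
count-insertAt-zero {m} {N} a h i aᵢ≡0 = begin
  count (suc m) a h
    ≡⟨ count-insertAt a h i ⟩
  ∑[ x ∈ boolVecs N ] δℤ (ones x) (a i) * rest x
    ≡⟨ ∑-cong (boolVecs N) (λ x → cong (_* rest x) (trans (cong (δℤ (ones x)) aᵢ≡0) (δℤ-+ (ones x) 0))) ⟩
  ∑[ x ∈ boolVecs N ] δ (ones x) 0 * rest x
    ≡⟨ ∑-ones≡0 N rest (λ x≗y → count-cong {a = removeAt a i} (λ _ → refl)
                                               (λ c v → cong (λ b → h c (bit b + v)) (x≗y c))) ⟩
  count m (removeAt a i) h
    ∎
  where
  open ≡-Reasoning
  rest : Vector Bool N → ℕ
  rest x = count m (removeAt a i) (shift (bit ∘ x) h)

-- binomialSum n f g = ∑ₖ (n choose k) f k g (n - k)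
binomialSum : ℕ → (ℕ → ℕ) → (ℕ → ℕ) → ℕ
binomialSum zero    f g = f 0 * g 0
binomialSum (suc n) f g = binomialSum n (f ∘ suc) g + binomialSum n f (g ∘ suc)

-- Summing f |x| * g |y| over the pairs of 0-1 vectors with x + y = s, where s has n₁ entries 1
-- and n₂ entries 2: every 2 puts a 1 into both x and y, every 1 goes to exactly one of them.
splitSum : ℕ → ℕ → (ℕ → ℕ) → (ℕ → ℕ) → ℕ
splitSum n₁ zero     f g = binomialSum n₁ f g
splitSum n₁ (suc n₂) f g = splitSum n₁ n₂ (f ∘ suc) (g ∘ suc)

splitSum-suc : (n₁ n₂ : ℕ) (f g : ℕ → ℕ) →
  splitSum (suc n₁) n₂ f g ≡ splitSum n₁ n₂ (f ∘ suc) g + splitSum n₁ n₂ f (g ∘ suc)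
splitSum-suc n₁ zero     f g = refl
splitSum-suc n₁ (suc n₂) f g = splitSum-suc n₁ n₂ (f ∘ suc) (g ∘ suc)

splitSum-cong : (n₁ n₂ : ℕ) {f f′ g g′ : ℕ → ℕ} → f ≗ f′ → g ≗ g′ →
  splitSum n₁ n₂ f g ≡ splitSum n₁ n₂ f′ g′
splitSum-cong n₁ zero     f≗f′ g≗g′ = binomialSum-cong n₁ f≗f′ g≗g′
  where
  binomialSum-cong : (n : ℕ) {f f′ g g′ : ℕ → ℕ} → f ≗ f′ → g ≗ g′ →
    binomialSum n f g ≡ binomialSum n f′ g′
  binomialSum-cong zero    f≗f′ g≗g′ = cong₂ _*_ (f≗f′ 0) (g≗g′ 0)
  binomialSum-cong (suc n) f≗f′ g≗g′ =
    cong₂ _+_ (binomialSum-cong n (f≗f′ ∘ suc) g≗g′) (binomialSum-cong n f≗f′ (g≗g′ ∘ suc))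
splitSum-cong n₁ (suc n₂) f≗f′ g≗g′ = splitSum-cong n₁ n₂ (f≗f′ ∘ suc) (g≗g′ ∘ suc)

ternaryVecs : (N : ℕ) → List (Vector ℕ N)
ternaryVecs N = allVecs N (0 ∷ 1 ∷ 2 ∷ [])

occurrences : {N : ℕ} → ℕ → Vector ℕ N → ℕ
occurrences {N} v s = sumFin N (λ n → if s n ℕ.≡ᵇ v then 1 else 0)

pairSum : (N : ℕ) → (ℕ → ℕ) → (ℕ → ℕ) → ColumnWeight N → ℕ
pairSum N f g h =
  ∑[ x ∈ boolVecs N ] f (ones x) * (∑[ y ∈ boolVecs N ] g (ones y) * ∏ (λ c → h c (bit (x c) + bit (y c))))

ternarySum : (N : ℕ) → (ℕ → ℕ) → (ℕ → ℕ) → ColumnWeight N → ℕ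
ternarySum N f g h =
  ∑[ s ∈ ternaryVecs N ] splitSum (occurrences 1 s) (occurrences 2 s) f g * ∏ (λ c → h c (s c))

pairSum-suc : (N : ℕ) (f g : ℕ → ℕ) (h : ColumnWeight (suc N)) →
  pairSum (suc N) f g h ≡ ∑[ x₀ ∈ true ∷ false ∷ [] ] ∑[ y₀ ∈ true ∷ false ∷ [] ]
    h zero (bit x₀ + bit y₀) * pairSum N (f ∘ (bit x₀ +_)) (g ∘ (bit y₀ +_)) (h ∘ suc)
pairSum-suc N f g h = begin
  pairSum (suc N) f g h
    ≡⟨ ∑-allVecs-suc N _ _ ⟩
  ∑[ x₀ ∈ bools ] ∑[ x ∈ boolVecs N ] f (bit x₀ + ones x) *
    (∑[ y ∈ boolVecs (suc N) ] g (ones y) * ∏ (λ c → h c (bit ((x₀ ∷ᵥ x) c) + bit (y c))))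
    ≡⟨ ∑-cong bools (λ x₀ → ∑-cong (boolVecs N) (λ x → cong (f (bit x₀ + ones x) *_) (begin
         ∑[ y ∈ boolVecs (suc N) ] g (ones y) * ∏ (λ c → h c (bit ((x₀ ∷ᵥ x) c) + bit (y c)))
           ≡⟨ ∑-allVecs-suc N _ _ ⟩
         ∑[ y₀ ∈ bools ] ∑[ y ∈ boolVecs N ] g (bit y₀ + ones y) * (h zero (bit x₀ + bit y₀) * P x y)
           ≡⟨ ∑-cong bools (λ y₀ →
                ∑-pull (h zero (bit x₀ + bit y₀)) (boolVecs N) (λ y → g (bit y₀ + ones y)) (P x)) ⟩
         ∑[ y₀ ∈ bools ] h zero (bit x₀ + bit y₀) * (∑[ y ∈ boolVecs N ] g (bit y₀ + ones y) * P x y)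
           ∎))) ⟩
  ∑[ x₀ ∈ bools ] ∑[ x ∈ boolVecs N ] f (bit x₀ + ones x) *
    (∑[ y₀ ∈ bools ] h zero (bit x₀ + bit y₀) * (∑[ y ∈ boolVecs N ] g (bit y₀ + ones y) * P x y))
    ≡⟨ ∑-cong bools (λ x₀ → ∑-interchange (boolVecs N) bools (λ x → f (bit x₀ + ones x))
         (λ y₀ → h zero (bit x₀ + bit y₀)) (λ x y₀ → ∑[ y ∈ boolVecs N ] g (bit y₀ + ones y) * P x y)) ⟩
  ∑[ x₀ ∈ bools ] ∑[ y₀ ∈ bools ]
    h zero (bit x₀ + bit y₀) * pairSum N (f ∘ (bit x₀ +_)) (g ∘ (bit y₀ +_)) (h ∘ suc)
    ∎
  where
  open ≡-Reasoning
  bools : List Bool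
  bools = true ∷ false ∷ []
  P : Vector Bool N → Vector Bool N → ℕ
  P x y = ∏ (λ c → h (suc c) (bit (x c) + bit (y c)))

ternarySum-suc : (N : ℕ) (f g : ℕ → ℕ) (h : ColumnWeight (suc N)) →
  ternarySum (suc N) f g h ≡
    h zero 0 * ternarySum N f g (h ∘ suc)
    + (h zero 1 * (ternarySum N (f ∘ suc) g (h ∘ suc) + ternarySum N f (g ∘ suc) (h ∘ suc))
    + (h zero 2 * ternarySum N (f ∘ suc) (g ∘ suc) (h ∘ suc) + 0))
ternarySum-suc N f g h =
  trans (∑-allVecs-suc N _ _) (cong₂ _+_ (∑-pull (h zero 0) S (V f g) P)
    (cong₂ _+_ ones-case (cong (_+ 0) (∑-pull (h zero 2) S (V (f ∘ suc) (g ∘ suc)) P))))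
  where
  S = ternaryVecs N
  V : (ℕ → ℕ) → (ℕ → ℕ) → Vector ℕ N → ℕ
  V f g s = splitSum (occurrences 1 s) (occurrences 2 s) f g
  P : Vector ℕ N → ℕ
  P s = ∏ (λ c → h (suc c) (s c))
  ones-case : ∑[ s ∈ S ] splitSum (suc (occurrences 1 s)) (occurrences 2 s) f g * (h zero 1 * P s)
            ≡ h zero 1 * (ternarySum N (f ∘ suc) g (h ∘ suc) + ternarySum N f (g ∘ suc) (h ∘ suc))
  ones-case = begin
    ∑[ s ∈ S ] splitSum (suc (occurrences 1 s)) (occurrences 2 s) f g * (h zero 1 * P s)
      ≡⟨ ∑-pull (h zero 1) S (λ s → splitSum (suc (occurrences 1 s)) (occurrences 2 s) f g) P ⟩
    h zero 1 * (∑[ s ∈ S ] splitSum (suc (occurrences 1 s)) (occurrences 2 s) f g * P s)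
      ≡⟨ cong (h zero 1 *_) (∑-cong S (λ s →
           trans (cong (_* P s) (splitSum-suc (occurrences 1 s) (occurrences 2 s) f g))
                 (*-distribʳ-+ (P s) (V (f ∘ suc) g s) (V f (g ∘ suc) s)))) ⟩
    h zero 1 * (∑[ s ∈ S ] V (f ∘ suc) g s * P s + V f (g ∘ suc) s * P s)
      ≡⟨ cong (h zero 1 *_) (∑-+ S (λ s → V (f ∘ suc) g s * P s) (λ s → V f (g ∘ suc) s * P s)) ⟩
    h zero 1 * (ternarySum N (f ∘ suc) g (h ∘ suc) + ternarySum N f (g ∘ suc) (h ∘ suc))
      ∎
    where open ≡-Reasoning

pairSum≡ternarySum : (N : ℕ) (f g : ℕ → ℕ) (h : ColumnWeight N) → pairSum N f g h ≡ ternarySum N f g h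
pairSum≡ternarySum zero    f g h = solve 2 (λ x y → x :* (y :* con 1 :+ con 0) :+ con 0 := x :* y :* con 1 :+ con 0)
                                            refl (f 0) (g 0)
pairSum≡ternarySum (suc N) f g h = begin
  pairSum (suc N) f g h
    ≡⟨ pairSum-suc N f g h ⟩
  combine (pairSum N f′ g′ h′) (pairSum N f′ g h′) (pairSum N f g′ h′) (pairSum N f g h′)
    ≡⟨ cong₂ (λ u v → combine u v (pairSum N f g′ h′) (pairSum N f g h′)) (IH f′ g′) (IH f′ g) ⟩
  combine (ternarySum N f′ g′ h′) (ternarySum N f′ g h′) (pairSum N f g′ h′) (pairSum N f g h′)
    ≡⟨ cong₂ (combine (ternarySum N f′ g′ h′) (ternarySum N f′ g h′)) (IH f g′) (IH f g) ⟩
  combine (ternarySum N f′ g′ h′) (ternarySum N f′ g h′) (ternarySum N f g′ h′) (ternarySum N f g h′)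
    ≡⟨ solve 7 (λ c₀ c₁ c₂ t₀₀ t₁₀ t₀₁ t₁₁ →
                  (c₂ :* t₁₁ :+ (c₁ :* t₁₀ :+ con 0)) :+ ((c₁ :* t₀₁ :+ (c₀ :* t₀₀ :+ con 0)) :+ con 0)
               := c₀ :* t₀₀ :+ (c₁ :* (t₁₀ :+ t₀₁) :+ (c₂ :* t₁₁ :+ con 0)))
         refl (h zero 0) (h zero 1) (h zero 2)
         (ternarySum N f g h′) (ternarySum N f′ g h′) (ternarySum N f g′ h′) (ternarySum N f′ g′ h′) ⟩
  h zero 0 * ternarySum N f g h′
    + (h zero 1 * (ternarySum N f′ g h′ + ternarySum N f g′ h′) + (h zero 2 * ternarySum N f′ g′ h′ + 0))
    ≡⟨ ternarySum-suc N f g h ⟨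
  ternarySum (suc N) f g h
    ∎
  where
  open ≡-Reasoning
  f′ = f ∘ suc
  g′ = g ∘ suc
  h′ = h ∘ suc
  IH : (f g : ℕ → ℕ) → pairSum N f g h′ ≡ ternarySum N f g h′
  IH f g = pairSum≡ternarySum N f g h′
  combine : ℕ → ℕ → ℕ → ℕ → ℕ
  combine t₁₁ t₁₀ t₀₁ t₀₀ =
    (h zero 2 * t₁₁ + (h zero 1 * t₁₀ + 0)) + ((h zero 1 * t₀₁ + (h zero 0 * t₀₀ + 0)) + 0)

∑-pairs-count : {N : ℕ} (n : ℕ) (f g : ℕ → ℕ) (a : Vector ℤ n) (h : ColumnWeight N) →
  ∑[ x ∈ boolVecs N ] f (ones x) *
    (∑[ y ∈ boolVecs N ] g (ones y) * count n a (shift (bit ∘ y) (shift (bit ∘ x) h)))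
  ≡ ∑[ s ∈ ternaryVecs N ] splitSum (occurrences 1 s) (occurrences 2 s) f g * count n a (shift s h)
∑-pairs-count {N} n f g a h = begin
  ∑[ x ∈ Xs ] f (ones x) * (∑[ y ∈ Xs ] g (ones y) * (∑[ M ∈ Ms ] R M * Q M x y))
    ≡⟨ ∑-cong Xs (λ x → cong (f (ones x) *_) (∑-interchange Xs Ms (g ∘ ones) R (λ y M → Q M x y))) ⟩
  ∑[ x ∈ Xs ] f (ones x) * (∑[ M ∈ Ms ] R M * (∑[ y ∈ Xs ] g (ones y) * Q M x y))
    ≡⟨ ∑-interchange Xs Ms (f ∘ ones) R (λ x M → ∑[ y ∈ Xs ] g (ones y) * Q M x y) ⟩
  ∑[ M ∈ Ms ] R M * (∑[ x ∈ Xs ] f (ones x) * (∑[ y ∈ Xs ] g (ones y) * Q M x y))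
    ≡⟨ ∑-cong Ms (λ M → cong (R M *_) (∑-cong Xs (λ x → cong (f (ones x) *_) (∑-cong Xs (λ y →
         cong (g (ones y) *_) (∏-cong (λ c → cong (h c) (sym (+-assoc (bit (x c)) (bit (y c)) _))))))))) ⟩
  ∑[ M ∈ Ms ] R M * pairSum N f g (h↑ M)
    ≡⟨ ∑-cong Ms (λ M → cong (R M *_) (pairSum≡ternarySum N f g (h↑ M))) ⟩
  ∑[ M ∈ Ms ] R M * ternarySum N f g (h↑ M)
    ≡⟨ ∑-interchange Ms (ternaryVecs N) R (λ s → splitSum (occurrences 1 s) (occurrences 2 s) f g)
                     (λ M s → ∏ (λ c → h↑ M c (s c))) ⟩
  ∑[ s ∈ ternaryVecs N ] splitSum (occurrences 1 s) (occurrences 2 s) f g * count n a (shift s h)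
    ∎
  where
  open ≡-Reasoning
  Xs = boolVecs N
  Ms = allVecs n (boolVecs N)
  R : Matrix n N → ℕ
  R M = ∏ (λ r → δℤ (ones (M r)) (a r))
  Q : Matrix n N → Vector Bool N → Vector Bool N → ℕ
  Q M x y = ∏ (λ c → h c (bit (x c) + (bit (y c) + columnSum M c)))
  h↑ : Matrix n N → ColumnWeight N
  h↑ M c t = h c (t + columnSum M c)

count-twoRows : {N : ℕ} (n : ℕ) (a : Vector ℤ (suc (suc n))) (h : ColumnWeight N)
  (i : Fin (suc (suc n))) (j : Fin (suc n)) →
  count (suc (suc n)) a h ≡
    ∑[ s ∈ ternaryVecs N ] splitSum (occurrences 1 s) (occurrences 2 s)
                             (λ k → δℤ k (a i)) (λ k → δℤ k (a (punchIn i j)))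
                           * count n (removeAt (removeAt a i) j) (shift s h)
count-twoRows {N} n a h i j =
  trans (count-insertAt a h i)
    (trans (∑-cong (boolVecs N) (λ x → cong (δℤ (ones x) (a i) *_)
                                             (count-insertAt (removeAt a i) (shift (bit ∘ x) h) j)))
           (∑-pairs-count n _ _ (removeAt (removeAt a i) j) h))

binomialSum-zeroˡ : (n : ℕ) (g : ℕ → ℕ) → binomialSum n (λ _ → 0) g ≡ 0
binomialSum-zeroˡ zero    g = refl
binomialSum-zeroˡ (suc n) g = cong₂ _+_ (binomialSum-zeroˡ n g) (binomialSum-zeroˡ n (g ∘ suc))

binomialSum-zeroʳ : (n : ℕ) (f : ℕ → ℕ) → binomialSum n f (λ _ → 0) ≡ 0
binomialSum-zeroʳ zero    f = *-zeroʳ (f 0)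
binomialSum-zeroʳ (suc n) f = cong₂ _+_ (binomialSum-zeroʳ n (f ∘ suc)) (binomialSum-zeroʳ n f)

splitSum-zeroʳ : (n₁ n₂ : ℕ) (f : ℕ → ℕ) → splitSum n₁ n₂ f (λ _ → 0) ≡ 0
splitSum-zeroʳ n₁ zero     f = binomialSum-zeroʳ n₁ f
splitSum-zeroʳ n₁ (suc n₂) f = splitSum-zeroʳ n₁ n₂ (f ∘ suc)

δ*nC[1+q] : (q n : ℕ) → δ q n * (n C suc q) ≡ 0
δ*nC[1+q] q n with q ℕ.≟ n
... | yes refl = trans (cong (_* (n C suc n)) (δ-refl n)) (trans (*-identityˡ _) (k>n⇒nCk≡0 (n<1+n n)))
... | no  q≢n  = cong (_* (n C suc q)) (δ-≢ q≢n)

binomialSum-δ : (n p q : ℕ) → binomialSum n (λ k → δ k p) (λ k → δ k q) ≡ δ (p + q) n * (n C q)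
binomialSum-δ zero    zero    zero    = refl
binomialSum-δ zero    zero    (suc q) = refl
binomialSum-δ zero    (suc p) q       = refl
binomialSum-δ (suc n) zero    zero    = cong₂ _+_ (binomialSum-zeroˡ n _) (binomialSum-zeroʳ n _)
binomialSum-δ (suc n) zero    (suc q) = begin
  binomialSum n (λ _ → 0) (λ k → δ k (suc q)) + binomialSum n (λ k → δ k 0) (λ k → δ k q)
    ≡⟨ cong₂ _+_ (binomialSum-zeroˡ n _) (binomialSum-δ n 0 q) ⟩
  δ q n * (n C q)
    ≡⟨ +-identityʳ _ ⟨
  δ q n * (n C q) + 0
    ≡⟨ cong (δ q n * (n C q) +_) (δ*nC[1+q] q n) ⟨
  δ q n * (n C q) + δ q n * (n C suc q)
    ≡⟨ *-distribˡ-+ (δ q n) _ _ ⟨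
  δ q n * (n C q + n C suc q)
    ≡⟨ cong (δ q n *_) (nCk+nC[k+1]≡[n+1]C[k+1] n q) ⟩
  δ q n * (suc n C suc q)
    ∎
  where open ≡-Reasoning
binomialSum-δ (suc n) (suc p) zero    =
  trans (cong₂ _+_ (binomialSum-δ n p 0) (binomialSum-zeroʳ n _)) (+-identityʳ _)
binomialSum-δ (suc n) (suc p) (suc q) = begin
  binomialSum n (λ k → δ k p) (λ k → δ k (suc q)) + binomialSum n (λ k → δ k (suc p)) (λ k → δ k q)
    ≡⟨ cong₂ _+_ (binomialSum-δ n p (suc q)) (binomialSum-δ n (suc p) q) ⟩
  δ (p + suc q) n * (n C suc q) + δ (suc p + q) n * (n C q)
    ≡⟨ cong (λ m → δ (p + suc q) n * (n C suc q) + δ m n * (n C q)) (+-suc p q) ⟨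
  δ (p + suc q) n * (n C suc q) + δ (p + suc q) n * (n C q)
    ≡⟨ *-distribˡ-+ (δ (p + suc q) n) _ _ ⟨
  δ (p + suc q) n * (n C suc q + n C q)
    ≡⟨ cong (δ (p + suc q) n *_) (trans (+-comm (n C suc q) (n C q)) (nCk+nC[k+1]≡[n+1]C[k+1] n q)) ⟩
  δ (p + suc q) n * (suc n C suc q)
    ∎
  where open ≡-Reasoning

splitSum-δ : {n₂ p q : ℕ} (n₁ : ℕ) → n₂ ≤ p → n₂ ≤ q →
  splitSum n₁ n₂ (λ k → δ k p) (λ k → δ k q) ≡ δ ((p ∸ n₂) + (q ∸ n₂)) n₁ * (n₁ C (q ∸ n₂))
splitSum-δ {p = p} {q} n₁ z≤n       z≤n       = binomialSum-δ n₁ p q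
splitSum-δ             n₁ (s≤s n₂≤p) (s≤s n₂≤q) = splitSum-δ n₁ n₂≤p n₂≤q

splitSum-δ-vanishes : {n₂ q : ℕ} (n₁ : ℕ) (f : ℕ → ℕ) → q < n₂ →
  splitSum n₁ n₂ f (λ k → δ k q) ≡ 0
splitSum-δ-vanishes {suc n₂} {zero}  n₁ f (s≤s z≤n)   = splitSum-zeroʳ n₁ n₂ (f ∘ suc)
splitSum-δ-vanishes {suc n₂} {suc q} n₁ f (s≤s q<n₂) = splitSum-δ-vanishes n₁ (f ∘ suc) q<n₂

∑-upTo-suc : (m : ℕ) (F : ℕ → ℕ) → ∑ (upTo (suc m)) F ≡ F 0 + (∑[ k ∈ upTo m ] F (suc k))
∑-upTo-suc m F = cong (F 0 +_) (trans (cong (λ ks → ∑ ks F) (sym (map-upTo suc m))) (∑-map (upTo m) suc F))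

∑-upTo-δ : {n m : ℕ} (F : ℕ → ℕ) → n ≤ m → ∑[ k ∈ upTo (suc m) ] δ n k * F k ≡ F n
∑-upTo-δ {m = m} F z≤n = trans (∑-upTo-suc m (λ k → δ 0 k * F k))
  (trans (cong₂ _+_ (*-identityˡ (F 0)) (∑-zero (upTo m) (λ _ → refl))) (+-identityʳ (F 0)))
∑-upTo-δ {suc n} {suc m} F (s≤s n≤m) =
  trans (∑-upTo-suc (suc m) (λ k → δ (suc n) k * F k)) (∑-upTo-δ (F ∘ suc) n≤m)

∑-upTo-δ-vanishes : {n m : ℕ} (F : ℕ → ℕ) → m < n → ∑[ k ∈ upTo (suc m) ] δ n k * F k ≡ 0
∑-upTo-δ-vanishes {suc n} {zero}  F (s≤s z≤n)  = refl
∑-upTo-δ-vanishes {suc n} {suc m} F (s≤s m<n) =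
  trans (∑-upTo-suc (suc m) (λ k → δ (suc n) k * F k)) (∑-upTo-δ-vanishes (F ∘ suc) m<n)

δ-cong-⇔ : {m n m′ n′ : ℕ} → (m ≡ n → m′ ≡ n′) → (m′ ≡ n′ → m ≡ n) → δ m n ≡ δ m′ n′
δ-cong-⇔ {m} {n} {m′} {n′} to from = cong bit (does-≡ (m ℕ.≟ n) (map′ from to (m′ ℕ.≟ n′)))

*-δ-cong : {m n x y : ℕ} → (m ≡ n → x ≡ y) → x * δ m n ≡ δ m n * y
*-δ-cong {m} {n} {x} {y} x≡y with m ℕ.≟ n
... | yes refl rewrite δ-refl m = trans (*-identityʳ x) (trans (x≡y refl) (sym (*-identityˡ y)))
... | no  m≢n  rewrite δ-≢ m≢n  = *-zeroʳ x

[p∸k]+[q∸k]+2k≡p+q : {k p q : ℕ} → k ≤ p → k ≤ q → (p ∸ k) + (q ∸ k) + 2 * k ≡ p + q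
[p∸k]+[q∸k]+2k≡p+q {k} {p} {q} k≤p k≤q = begin
  (p ∸ k) + (q ∸ k) + 2 * k   ≡⟨ solve 3 (λ x y z → x :+ y :+ con 2 :* z := (x :+ z) :+ (y :+ z))
                                         refl (p ∸ k) (q ∸ k) k ⟩
  (p ∸ k + k) + (q ∸ k + k)   ≡⟨ cong₂ _+_ (m∸n+n≡m k≤p) (m∸n+n≡m k≤q) ⟩
  p + q                       ∎
  where open ≡-Reasoning

splitSum-δ-≤ : {n₂ p q : ℕ} (n₁ : ℕ) → n₂ ≤ q → q ≤ p →
  splitSum n₁ n₂ (λ k → δ k p) (λ k → δ k q) ≡ δ (n₁ + 2 * n₂) (p + q) * (n₁ C (q ∸ n₂))
splitSum-δ-≤ {n₂} {p} {q} n₁ n₂≤q q≤p =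
  trans (splitSum-δ n₁ n₂≤p n₂≤q) (cong (_* (n₁ C (q ∸ n₂))) (δ-cong-⇔ to from))
  where
  n₂≤p = ≤-trans n₂≤q q≤p
  to : (p ∸ n₂) + (q ∸ n₂) ≡ n₁ → n₁ + 2 * n₂ ≡ p + q
  to eq = trans (cong (_+ 2 * n₂) (sym eq)) ([p∸k]+[q∸k]+2k≡p+q n₂≤p n₂≤q)
  from : n₁ + 2 * n₂ ≡ p + q → (p ∸ n₂) + (q ∸ n₂) ≡ n₁
  from eq = +-cancelʳ-≡ (2 * n₂) _ _ (trans ([p∸k]+[q∸k]+2k≡p+q n₂≤p n₂≤q) (sym eq))

∣+m-+n∣≡m∸n : {m n : ℕ} → n ≤ m → ℤ.∣ ℤ.+ m ℤ.- ℤ.+ n ∣ ≡ m ∸ n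
∣+m-+n∣≡m∸n {m} {n} n≤m = cong ℤ.∣_∣ (trans (ℤ.m-n≡m⊖n m n) (ℤ.⊖-≥ n≤m))

coefficient : (p q k : ℕ) → ℕ
coefficient p q k = ℤ.∣ ℤ.+ p ℤ.+ ℤ.+ q ℤ.- ℤ.+ 2 ℤ.* ℤ.+ k ∣ C ℤ.∣ ℤ.+ q ℤ.- ℤ.+ k ∣

coefficient-≡ : {n₁ p q k : ℕ} → k ≤ q → n₁ + 2 * k ≡ p + q → coefficient p q k ≡ n₁ C (q ∸ k)
coefficient-≡ {n₁} {p} {q} {k} k≤q eq = cong₂ _C_ top (∣+m-+n∣≡m∸n k≤q)
  where
  top : ℤ.∣ ℤ.+ (p + q) ℤ.- ℤ.+ 2 ℤ.* ℤ.+ k ∣ ≡ n₁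
  top = begin
    ℤ.∣ ℤ.+ (p + q) ℤ.- ℤ.+ 2 ℤ.* ℤ.+ k ∣ ≡⟨ cong (λ z → ℤ.∣ ℤ.+ (p + q) ℤ.- z ∣) (ℤ.pos-* 2 k) ⟨
    ℤ.∣ ℤ.+ (p + q) ℤ.- ℤ.+ (2 * k) ∣    ≡⟨ ∣+m-+n∣≡m∸n (subst (2 * k ≤_) eq (m≤n+m (2 * k) n₁)) ⟩
    p + q ∸ 2 * k                         ≡⟨ cong (_∸ 2 * k) eq ⟨
    n₁ + 2 * k ∸ 2 * k                    ≡⟨ m+n∸n≡m n₁ (2 * k) ⟩
    n₁                                    ∎
    where open ≡-Reasoning

∑-coefficients : {n₁ n₂ p q σ : ℕ} → q ≤ p → σ ≡ n₁ + 2 * n₂ →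
  ∑[ k ∈ upTo (suc q) ] coefficient p q k * bit ((n₂ ℕ.≡ᵇ k) ∧ ⌊ ℤ.+ σ ℤ.≟ ℤ.+ p ℤ.+ ℤ.+ q ⌋)
  ≡ splitSum n₁ n₂ (λ k → δ k p) (λ k → δ k q)
∑-coefficients {n₁} {n₂} {p} {q} {σ} q≤p σ≡ = begin
  ∑[ k ∈ upTo (suc q) ] coefficient p q k * bit ((n₂ ℕ.≡ᵇ k) ∧ ⌊ ℤ.+ σ ℤ.≟ ℤ.+ (p + q) ⌋)
    ≡⟨ ∑-cong (upTo (suc q)) (λ k → trans
         (cong (coefficient p q k *_) (trans (bit-∧ (n₂ ℕ.≡ᵇ k) _) (cong (δ n₂ k *_) (δℤ-+ σ (p + q)))))
         (*-left-comm (coefficient p q k) (δ n₂ k) _)) ⟩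
  ∑[ k ∈ upTo (suc q) ] δ n₂ k * (coefficient p q k * δ σ (p + q))
    ≡⟨ collapse (n₂ ≤? q) ⟩
  splitSum n₁ n₂ (λ k → δ k p) (λ k → δ k q)
    ∎
  where
  open ≡-Reasoning
  collapse : Dec (n₂ ≤ q) → ∑[ k ∈ upTo (suc q) ] δ n₂ k * (coefficient p q k * δ σ (p + q))
                           ≡ splitSum n₁ n₂ (λ k → δ k p) (λ k → δ k q)
  collapse (yes n₂≤q) = begin
    ∑[ k ∈ upTo (suc q) ] δ n₂ k * (coefficient p q k * δ σ (p + q))
      ≡⟨ ∑-upTo-δ (λ k → coefficient p q k * δ σ (p + q)) n₂≤q ⟩
    coefficient p q n₂ * δ σ (p + q)
      ≡⟨ *-δ-cong (λ σ≡p+q → coefficient-≡ n₂≤q (trans (sym σ≡) σ≡p+q)) ⟩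
    δ σ (p + q) * (n₁ C (q ∸ n₂))
      ≡⟨ cong (λ m → δ m (p + q) * (n₁ C (q ∸ n₂))) σ≡ ⟩
    δ (n₁ + 2 * n₂) (p + q) * (n₁ C (q ∸ n₂))
      ≡⟨ splitSum-δ-≤ n₁ n₂≤q q≤p ⟨
    splitSum n₁ n₂ (λ k → δ k p) (λ k → δ k q)
      ∎
  collapse (no n₂≰q) =
    trans (∑-upTo-δ-vanishes _ (≰⇒> n₂≰q)) (sym (splitSum-δ-vanishes n₁ _ (≰⇒> n₂≰q)))

sumFin-ternary : (N : ℕ) (s : Vector ℕ N) → (∀ c → s c ∈ 0 ∷ 1 ∷ 2 ∷ []) →
  sumFin N s ≡ occurrences 1 s + 2 * occurrences 2 s
sumFin-ternary zero    s s∈ = refl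
sumFin-ternary (suc N) s s∈ with s zero | s∈ zero | sumFin-ternary N (s ∘ suc) (s∈ ∘ suc)
... | _ | here refl                 | IH = IH
... | _ | there (here refl)         | IH = cong suc IH
... | _ | there (there (here refl)) | IH = trans (cong (2 +_) IH)
  (solve 2 (λ x y → con 2 :+ (x :+ con 2 :* y) := x :+ con 2 :* (con 1 :+ y)) refl
     (occurrences 1 (s ∘ suc)) (occurrences 2 (s ∘ suc)))

e-same : {N : ℕ} (k : Fin N) → e k k ≡ ℤ.+ 1
e-same k with k Fin.≟ k
... | yes _   = refl
... | no  k≢k = contradiction refl k≢k

e-other : {N : ℕ} {k m : Fin N} → k ≢ m → e k m ≡ ℤ.+ 0
e-other {k = k} {m} k≢m with k Fin.≟ m
... | yes k≡m = contradiction k≡m k≢m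
... | no  _   = refl

clearRows : {N : ℕ} → Vector ℤ N → Fin N → Fin N → Vector ℤ N
clearRows a i j = (a -ᵥ (a i ·ᵥ e i)) -ᵥ (a j ·ᵥ e j)

x-y*0≡x : (x y : ℤ) → x ℤ.- y ℤ.* ℤ.+ 0 ≡ x
x-y*0≡x x y = trans (cong (ℤ._-_ x) (ℤ.*-zeroʳ y)) (ℤ.+-identityʳ x)

x-x*1≡0 : (x : ℤ) → x ℤ.- x ℤ.* ℤ.+ 1 ≡ ℤ.+ 0
x-x*1≡0 x = trans (cong (ℤ._-_ x) (ℤ.*-identityʳ x)) (ℤ.+-inverseʳ x)

module _ {N : ℕ} (a : Vector ℤ N) {i j : Fin N} (i≢j : i ≢ j) where

  clearRows-first : clearRows a i j i ≡ ℤ.+ 0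
  clearRows-first = trans (cong₂ (λ u v → (a i ℤ.- a i ℤ.* u) ℤ.- a j ℤ.* v) (e-same i) (e-other (i≢j ∘ sym)))
                          (trans (x-y*0≡x _ (a j)) (x-x*1≡0 (a i)))

  clearRows-second : clearRows a i j j ≡ ℤ.+ 0
  clearRows-second = trans (cong₂ (λ u v → (a j ℤ.- a i ℤ.* u) ℤ.- a j ℤ.* v) (e-other i≢j) (e-same j))
                           (trans (cong (ℤ._- a j ℤ.* ℤ.+ 1) (x-y*0≡x (a j) (a i))) (x-x*1≡0 (a j)))

  clearRows-other : {r : Fin N} → i ≢ r → j ≢ r → clearRows a i j r ≡ a r
  clearRows-other {r} i≢r j≢r =
    trans (cong₂ (λ u v → (a r ℤ.- a i ℤ.* u) ℤ.- a j ℤ.* v) (e-other i≢r) (e-other j≢r))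
          (trans (x-y*0≡x _ (a j)) (x-y*0≡x (a r) (a i)))

module _ {n : ℕ} (a b : Vector ℤ (suc (suc n))) (i : Fin (suc (suc n))) (j : Fin (suc n)) where

  private
    S : List (Vector ℕ (suc (suc n)))
    S = ternaryVecs (suc (suc n))

    fibreCount : Vector ℕ (suc (suc n)) → ℕ
    fibreCount s = count n (removeAt (removeAt a i) j) (shift s (λ c v → δℤ v (b c)))

    inFibre : ℤ → ℤ → ℕ → Vector ℕ (suc (suc n)) → Bool
    inFibre x y k s = (occurrences 2 s ℕ.≡ᵇ k) ∧ ⌊ ℤ.+ sumFin (suc (suc n)) s ℤ.≟ x ℤ.+ y ⌋

    -- rhs with a i and a j abstracted (except inside fibreCount), so they can be split into cases
    fibreRhs : ℤ → ℤ → ℕ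
    fibreRhs x y = ∑[ k ∈ range0 y ] (ℤ.∣ x ℤ.+ y ℤ.- ℤ.+ 2 ℤ.* ℤ.+ k ∣ C ℤ.∣ y ℤ.- ℤ.+ k ∣)
                                     * (∑[ s ∈ S ] bit (inFibre x y k s) * fibreCount s)

  countG-fibres : countG a b ≡ ∑[ s ∈ S ] splitSum (occurrences 1 s) (occurrences 2 s)
                    (λ k → δℤ k (a i)) (λ k → δℤ k (a (punchIn i j))) * fibreCount s
  countG-fibres = trans (countG≡count a b) (count-twoRows n a (λ c v → δℤ v (b c)) i j)

  countG-clearRows : (s : Vector ℕ (suc (suc n))) →
    countG (clearRows a i (punchIn i j)) (b -ᵥ toℤv s) ≡ fibreCount s
  countG-clearRows s = begin
    countG a′ (b -ᵥ toℤv s)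
      ≡⟨ countG≡count a′ (b -ᵥ toℤv s) ⟩
    count (suc (suc n)) a′ h
      ≡⟨ count-insertAt-zero a′ h i (clearRows-first a i≢j) ⟩
    count (suc n) (removeAt a′ i) h
      ≡⟨ count-insertAt-zero (removeAt a′ i) h j (clearRows-second a i≢j) ⟩
    count n (removeAt (removeAt a′ i) j) h
      ≡⟨ count-cong (λ r → clearRows-other a i≢j (i≢ r) (j≢ r)) (λ c v → δℤ-shift v (s c) (b c)) ⟩
    fibreCount s
      ∎
    where
    open ≡-Reasoning
    a′ = clearRows a i (punchIn i j)
    h : ColumnWeight (suc (suc n))
    h c v = δℤ v (b c ℤ.- ℤ.+ s c)
    i≢j : i ≢ punchIn i j
    i≢j = punchInᵢ≢i i j ∘ sym
    i≢ : (r : Fin n) → i ≢ punchIn i (punchIn j r)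
    i≢ r = punchInᵢ≢i i (punchIn j r) ∘ sym
    j≢ : (r : Fin n) → punchIn i j ≢ punchIn i (punchIn j r)
    j≢ r = punchInᵢ≢i j r ∘ sym ∘ punchIn-injective i j (punchIn j r)

  rhs-fibres : rhs a b i (punchIn i j) ≡ fibreRhs (a i) (a (punchIn i j))
  rhs-fibres = ∑-cong (range0 (a (punchIn i j))) (λ k →
    cong ((ℤ.∣ a i ℤ.+ a (punchIn i j) ℤ.- ℤ.+ 2 ℤ.* ℤ.+ k ∣ C ℤ.∣ a (punchIn i j) ℤ.- ℤ.+ k ∣) *_)
    (trans (∑-filterᵇ (inFibre (a i) (a (punchIn i j)) k) S _)
           (∑-cong S (λ s → cong (bit (inFibre (a i) (a (punchIn i j)) k s) *_) (countG-clearRows s)))))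

  fibres-agree : (x y : ℤ) → a i ≡ x → a (punchIn i j) ≡ y → y ℤ.≤ x →
    ∑[ s ∈ S ] splitSum (occurrences 1 s) (occurrences 2 s) (λ k → δℤ k (a i)) (λ k → δℤ k (a (punchIn i j)))
                 * fibreCount s
    ≡ fibreRhs x y
  fibres-agree x -[1+ m ] _ aⱼ≡ _ = ∑-zero S (λ s → cong (_* fibreCount s)
    (trans (splitSum-cong (occurrences 1 s) (occurrences 2 s) (λ _ → refl) (λ k → cong (δℤ k) aⱼ≡))
           (splitSum-zeroʳ (occurrences 1 s) (occurrences 2 s) _)))
  fibres-agree (ℤ.+ p) (ℤ.+ q) aᵢ≡ aⱼ≡ (ℤ.+≤+ q≤p) = begin
    ∑[ s ∈ S ] splitSum (occurrences 1 s) (occurrences 2 s) (λ k → δℤ k (a i)) (λ k → δℤ k (a (punchIn i j)))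
                 * fibreCount s
      ≡⟨ ∑-cong S (λ s → cong (_* fibreCount s) (splitSum-cong (occurrences 1 s) (occurrences 2 s)
           (λ k → trans (cong (δℤ k) aᵢ≡) (δℤ-+ k p)) (λ k → trans (cong (δℤ k) aⱼ≡) (δℤ-+ k q)))) ⟩
    ∑[ s ∈ S ] splitSum (occurrences 1 s) (occurrences 2 s) (λ k → δ k p) (λ k → δ k q) * fibreCount s
      ≡⟨ ∑-allVecs-cong (suc (suc n)) _ (λ {s} s∈ → trans
           (cong (_* fibreCount s) (sym (∑-coefficients {occurrences 1 s} {occurrences 2 s} q≤p
                                                         (sumFin-ternary (suc (suc n)) s s∈))))
           (*-comm _ (fibreCount s))) ⟩
    ∑[ s ∈ S ] fibreCount s * (∑[ k ∈ upTo (suc q) ] coefficient p q k * bit (φ k s))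
      ≡⟨ ∑-interchange (upTo (suc q)) S (coefficient p q) fibreCount (λ k s → bit (φ k s)) ⟨
    ∑[ k ∈ upTo (suc q) ] coefficient p q k * (∑[ s ∈ S ] fibreCount s * bit (φ k s))
      ≡⟨ ∑-cong (upTo (suc q)) (λ k →
           cong (coefficient p q k *_) (∑-cong S (λ s → *-comm (fibreCount s) _))) ⟩
    fibreRhs (ℤ.+ p) (ℤ.+ q)
      ∎
    where
    open ≡-Reasoning
    φ = inFibre (ℤ.+ p) (ℤ.+ q)

  countG≡rhs : a (punchIn i j) ℤ.≤ a i → countG a b ≡ rhs a b i (punchIn i j)
  countG≡rhs aⱼ≤aᵢ = begin
    countG a b                                  ≡⟨ countG-fibres ⟩
    _                                           ≡⟨ fibres-agree (a i) (a (punchIn i j)) refl refl aⱼ≤aᵢ ⟩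
    fibreRhs (a i) (a (punchIn i j))            ≡⟨ rhs-fibres ⟨
    rhs a b i (punchIn i j)                     ∎
    where open ≡-Reasoning

theorem1 : (N : ℕ) (a b : Vector ℤ N) (i j : Fin N) →
    i ≢ j → a j ℤ.≤ a i →
    countG a b ≡ rhs a b i j
theorem1 (suc zero)    a b zero zero i≢j _     = contradiction refl i≢j
theorem1 (suc (suc n)) a b i    j    i≢j aⱼ≤aᵢ =
  subst (λ j → countG a b ≡ rhs a b i j) (punchIn-punchOut i≢j)
        (countG≡rhs a b i (punchOut i≢j) (subst (λ j → a j ℤ.≤ a i) (sym (punchIn-punchOut i≢j)) aⱼ≤aᵢ))
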